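{- Let $G=\mathbb{Z}_{q_1}\oplus\cdots\oplus\mathbb{Z}_{q_m}$ (each $q_i$ a prime power) act on a finite set $X$, fix $x\in X$, and let $G'=\mathbb{Z}_{n_1}\oplus\cdots\oplus\mathbb{Z}_{n_m}$ and $G'_x$ be as in the context. Then every nonzero element of $G'_x$ is a multiple of exactly one minimal element of $G'_x$.
   Context: Let $e_i$ denote the $i$-th standard generator of $G$. For the fixed $x\in X$, let $n_i$ be the smallest positive integer with $(n_ie_i)\cdot x=x$, and let $G'=\mathbb{Z}_{n_1}\oplus\cdots\oplus\mathbb{Z}_{n_m}$. Since $G$ is abelian, $G'$ acts on the orbit $G\cdot x$ by $(b_1,\dots,b_m)\cdot y=(b_1e_1+\cdots+b_me_m)\cdot y$; $G'_x$ denotes the stabilizer of $x$ under this action. Elements of $G'$ are represented as $m$-tuples $(a_1,\dots,a_m)$ of integers with $0\le a_i<n_i$. For $g,h\in G'_x$, "$g$ is a multiple of $h$" means $g=kh$ as $m$-tuples of nonnegative integers (coordinatewise, without reduction) for some positive integer $k$. An element $g\in G'_x$ is called minimal if it is not a multiple of any element of $G'_x$ other than itself. -}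

module Defs where

open import Data.Nat using (ℕ; zero; suc; _+_; _*_; _^_; _≤_; _<_; NonZero)
open import Data.Nat.Properties using (m^n≢0)
open import Data.Nat.DivMod using (_mod_)
open import Data.Nat.Primality using (Prime; prime⇒nonZero)
open import Data.Fin using (Fin; toℕ; _≟_)
open import Data.Product using (Σ; _×_; _,_)
open import Relation.Nullary using (¬_; yes; no)
open import Relation.Binary.PropositionalEquality using (_≡_; _≢_; subst; sym)

record IsPrimePower (q : ℕ) : Set where
  field
    p     : ℕ
    k     : ℕ
    prime : Prime p
    k≥1   : 1 ≤ k
    q≡p^k : q ≡ p ^ k

primePower⇒nonZero : ∀ {q} → IsPrimePower q → NonZero q
primePower⇒nonZero {q} pp =
  subst NonZero (sym q≡p^k) (m^n≢0 p k {{prime⇒nonZero prime}})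
  where open IsPrimePower pp

module _ {m : ℕ} (q : Fin m → ℕ) (pp : (i : Fin m) → IsPrimePower (q i)) where

  private
    nz : (i : Fin m) → NonZero (q i)
    nz i = primePower⇒nonZero (pp i)

  Grp : Set
  Grp = (i : Fin m) → Fin (q i)

  red : (i : Fin m) → ℕ → Fin (q i)
  red i a = _mod_ a (q i) {{nz i}}

  zeroG : Grp
  zeroG i = red i 0

  _+G_ : Grp → Grp → Grp
  (g +G h) i = red i (toℕ (g i) + toℕ (h i))

  multGen : ℕ → Fin m → Grp
  multGen c i j with j ≟ i
  ... | yes _ = red j c
  ... | no  _ = zeroG j

  combine : ((i : Fin m) → ℕ) → Grp
  combine b j = red j (b j)

  record Action (N : ℕ) : Set where
    field
      act     : Grp → Fin N → Fin N
      act-cong : ∀ g h → (∀ i → g i ≡ h i) → ∀ y → act g y ≡ act h y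
      act-zero : ∀ y → act zeroG y ≡ y
      act-add  : ∀ g h y → act (g +G h) y ≡ act g (act (h) y)

  module _ {N : ℕ} (A : Action N) (x : Fin N) where
    open Action A

    IsOrbitOrder : (n : Fin m → ℕ) → Set
    IsOrbitOrder n = ∀ i → (0 < n i) × (act (multGen (n i) i) x ≡ x)
                         × (∀ c → 0 < c → c < n i → act (multGen c i) x ≢ x)

    module _ (n : Fin m → ℕ) where
      InG' : ((i : Fin m) → ℕ) → Set
      InG' a = ∀ i → a i < n i

      InStab : ((i : Fin m) → ℕ) → Set
      InStab a = InG' a × (act (combine a) x ≡ x)

      IsMultiple : ((i : Fin m) → ℕ) → ((i : Fin m) → ℕ) → Set
      IsMultiple g h = Σ ℕ λ k → (0 < k) × (∀ i → g i ≡ k * h i)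

      IsMinimal : ((i : Fin m) → ℕ) → Set
      IsMinimal g = InStab g × (∀ h → InStab h → IsMultiple g h → ∀ i → h i ≡ g i)

      IsNonzero : ((i : Fin m) → ℕ) → Set
      IsNonzero a = ¬ (∀ i → a i ≡ 0)

module Submission where

-- Since G acts through an abelian group, the tuples fixing x are
-- closed under sums, differences and scalar multiples; by Bézout, if a·u and
-- b·u fix x with gcd(a,b) = 1 then u fixes x.
--
-- Uniqueness.  If g = k₁h₁ = k₂h₂ with h₁, h₂ minimal, divide k₁, k₂ by their
-- gcd to get coprime a, b with a·h₁ = b·h₂.  Then h₁ = b·u and h₂ = a·u for a
-- tuple u, which lies in G'ₓ by the Bézout closure; minimality of h₁ forces
-- u = h₁, and then minimality of h₂ (now h₂ = a·h₁) forces h₁ = h₂.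
--
-- Existence.  Pick a coordinate i₀ with gᵢ₀ ≠ 0.  Either g is minimal, or
-- g = k·h with k ≥ 2 and h ∈ G'ₓ (a decidable bounded search); in the latter
-- case hᵢ₀ < gᵢ₀, and well-founded induction on gᵢ₀ finishes the argument.

open import Defs
open import Data.Nat using (ℕ; zero; suc; _+_; _*_; _≤_; _<_; NonZero; z<s; s<s; >-nonZero)
open import Data.Nat.Properties
open import Data.Nat.DivMod using (_%_; _/_; m%n<n; %-distribˡ-+; m*n/n≡m; m*[n/m]≡n; m/n≤m; m/n<m)
open import Data.Nat.Divisibility using (_∣_; divides; _∣?_)
open _∣_ using (quotient; equality)
open import Data.Nat.GCD using (gcd; gcd[m,n]∣m; gcd[m,n]∣n; module Bézout)
open import Data.Nat.Coprimality using (Coprime; coprime-/gcd; coprime-Bézout; coprime-divisor)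
import Data.Nat.Coprimality as Coprimality
open import Data.Nat.Induction using (<-wellFounded)
open import Induction.WellFounded using (Acc; acc)
open import Data.Fin using (Fin; toℕ; fromℕ<)
import Data.Fin as Fin
open import Data.Fin.Properties using (toℕ-injective; toℕ-fromℕ<; any?; all?; ¬∀⟶∃¬)
open import Data.Vec.Functional using (Vector)
open import Data.Product using (Σ; _×_; _,_; proj₁; proj₂)
open import Data.Sum using (_⊎_; inj₁; inj₂)
open import Data.Empty using (⊥-elim)
open import Relation.Nullary using (¬_; yes; no; Dec; _×-dec_)
open import Relation.Binary.PropositionalEquality

_·_ : ∀ {m} → ℕ → Vector ℕ m → Vector ℕ m
(k · v) i = k * v i

infixr 7 _·_

factors-positive : ∀ a d → 0 < a * d → 0 < a × 0 < d
factors-positive (suc a) (suc d) _ = z<s , z<s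
factors-positive zero    d       ()
factors-positive (suc a) zero    p = ⊥-elim (<-irrefl (sym (*-zeroʳ a)) p)

cancel-gcd : ∀ {m} (h₁ h₂ : Vector ℕ m) k₁ k₂ → 0 < k₁ → 0 < k₂ →
             (∀ i → k₁ * h₁ i ≡ k₂ * h₂ i) →
             Σ ℕ λ a → Σ ℕ λ b → 0 < a × 0 < b × Coprime a b × (∀ i → a * h₁ i ≡ b * h₂ i)
cancel-gcd h₁ h₂ k₁ k₂ k₁>0 k₂>0 eq
  with gcd[m,n]∣m k₁ k₂ | gcd[m,n]∣n k₁ k₂
... | divides a k₁≡ad | divides b k₂≡bd =
  a , b , a>0 , b>0 , coprime , scaled-eq
  where
    d = gcd k₁ k₂
    a>0 = proj₁ (factors-positive a d (subst (0 <_) k₁≡ad k₁>0))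
    b>0 = proj₁ (factors-positive b d (subst (0 <_) k₂≡bd k₂>0))
    instance
      d≢0 : NonZero d
      d≢0 = >-nonZero (proj₂ (factors-positive a d (subst (0 <_) k₁≡ad k₁>0)))
    coprime : Coprime a b
    coprime = subst₂ Coprime (trans (cong (_/ d) k₁≡ad) (m*n/n≡m a d))
                             (trans (cong (_/ d) k₂≡bd) (m*n/n≡m b d))
                             (coprime-/gcd k₁ k₂)
    scaled-eq : ∀ i → a * h₁ i ≡ b * h₂ i
    scaled-eq i = *-cancelˡ-≡ (a * h₁ i) (b * h₂ i) d (begin
      d * (a * h₁ i) ≡⟨ sym (*-assoc d a (h₁ i)) ⟩
      d * a * h₁ i   ≡⟨ cong (_* h₁ i) (trans (*-comm d a) (sym k₁≡ad)) ⟩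
      k₁ * h₁ i      ≡⟨ eq i ⟩
      k₂ * h₂ i      ≡⟨ cong (_* h₂ i) (trans k₂≡bd (*-comm b d)) ⟩
      d * b * h₂ i   ≡⟨ *-assoc d b (h₂ i) ⟩
      d * (b * h₂ i) ∎)
      where open ≡-Reasoning

coprime-common-part : ∀ {m} (h₁ h₂ : Vector ℕ m) a b → 0 < b → Coprime a b →
                      (∀ i → a * h₁ i ≡ b * h₂ i) →
                      Σ (Vector ℕ m) λ u → (∀ i → h₁ i ≡ b * u i) × (∀ i → h₂ i ≡ a * u i)
coprime-common-part h₁ h₂ a b b>0 coprime eq = u , h₁≡bu , h₂≡au
  where
    instance
      b≢0 : NonZero b
      b≢0 = >-nonZero b>0
    b∣h₁ : ∀ i → b ∣ h₁ i
    b∣h₁ i = coprime-divisor (Coprimality.sym coprime)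
                             (divides (h₂ i) (trans (eq i) (*-comm b (h₂ i))))
    u : Vector ℕ _
    u i = quotient (b∣h₁ i)
    h₁≡bu : ∀ i → h₁ i ≡ b * u i
    h₁≡bu i = trans (equality (b∣h₁ i)) (*-comm (u i) b)
    h₂≡au : ∀ i → h₂ i ≡ a * u i
    h₂≡au i = *-cancelˡ-≡ (h₂ i) (a * u i) b (begin
      b * h₂ i       ≡⟨ sym (eq i) ⟩
      a * h₁ i       ≡⟨ cong (a *_) (h₁≡bu i) ⟩
      a * (b * u i)  ≡⟨ sym (*-assoc a b (u i)) ⟩
      a * b * u i    ≡⟨ cong (_* u i) (*-comm a b) ⟩
      b * a * u i    ≡⟨ *-assoc b a (u i) ⟩
      b * (a * u i)  ∎)
      where open ≡-Reasoning

module Fixing {m : ℕ} (q : Fin m → ℕ) (pp : (i : Fin m) → IsPrimePower (q i))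
              {N : ℕ} (A : Action q pp N) (x : Fin N) where
  open Action A

  Fixes : Vector ℕ m → Set
  Fixes v = act (combine q pp v) x ≡ x

  -- Reduction modulo qᵢ is additive, so combine is a homomorphism from ℕᵐ.
  red-+ : ∀ i a b → red q pp i (a + b) ≡ red q pp i (toℕ (red q pp i a) + toℕ (red q pp i b))
  red-+ i a b = toℕ-injective (begin
      toℕ (red q pp i (a + b))                          ≡⟨ toℕ-fromℕ< _ ⟩
      (a + b) % q i                                     ≡⟨ %-distribˡ-+ a b (q i) ⟩
      (a % q i + b % q i) % q i                         ≡⟨ cong₂ (λ r s → (r + s) % q i)
                                                              (sym (toℕ-fromℕ< (m%n<n a (q i))))
                                                              (sym (toℕ-fromℕ< (m%n<n b (q i)))) ⟩
      (toℕ (red q pp i a) + toℕ (red q pp i b)) % q i   ≡⟨ sym (toℕ-fromℕ< _) ⟩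
      toℕ (red q pp i (toℕ (red q pp i a) + toℕ (red q pp i b))) ∎)
    where
      open ≡-Reasoning
      instance _ = primePower⇒nonZero (pp i)

  act-combine-+ : ∀ (v w : Vector ℕ m) y →
                  act (combine q pp (λ i → v i + w i)) y ≡ act (combine q pp v) (act (combine q pp w) y)
  act-combine-+ v w y = trans (act-cong _ _ (λ i → red-+ i (v i) (w i)) y) (act-add _ _ y)

  fixes-cong : ∀ {v w : Vector ℕ m} → (∀ i → v i ≡ w i) → Fixes v → Fixes w
  fixes-cong v≗w fixed = trans (act-cong _ _ (λ i → cong (red q pp i) (sym (v≗w i))) x) fixed

  fixes-+ : ∀ (v w : Vector ℕ m) → Fixes v → Fixes w → Fixes (λ i → v i + w i)
  fixes-+ v w fv fw = trans (act-combine-+ v w x) (trans (cong (act (combine q pp v)) fw) fv)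

  fixes-∸ : ∀ (v w : Vector ℕ m) → Fixes (λ i → v i + w i) → Fixes w → Fixes v
  fixes-∸ v w fvw fw = trans (cong (act (combine q pp v)) (sym fw)) (trans (sym (act-combine-+ v w x)) fvw)

  fixes-· : ∀ k (v : Vector ℕ m) → Fixes v → Fixes (k · v)
  fixes-· zero    v fv = act-zero x
  fixes-· (suc k) v fv = fixes-+ v (k · v) fv (fixes-· k v fv)

  fixes-·-assoc : ∀ c a (u : Vector ℕ m) → Fixes (a · u) → Fixes ((c * a) · u)
  fixes-·-assoc c a u fau = fixes-cong (λ i → sym (*-assoc c a (u i))) (fixes-· c (a · u) fau)

  fixes-bézout : ∀ s t a b (u : Vector ℕ m) → 1 + t * b ≡ s * a →
                 Fixes (a · u) → Fixes (b · u) → Fixes u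
  fixes-bézout s t a b u bézout fau fbu =
    fixes-∸ u ((t * b) · u)
      (fixes-cong (λ i → cong (_* u i) (sym bézout)) (fixes-·-assoc s a u fau))
      (fixes-·-assoc t b u fbu)

  fixes-coprime : ∀ a b (u : Vector ℕ m) → Coprime a b →
                  Fixes (a · u) → Fixes (b · u) → Fixes u
  fixes-coprime a b u coprime fau fbu with coprime-Bézout coprime
  ... | Bézout.Identity.+- s t bézout = fixes-bézout s t a b u bézout fau fbu
  ... | Bézout.Identity.-+ s t bézout = fixes-bézout t s b a u bézout fbu fau

module Stabilizer {m : ℕ} (q : Fin m → ℕ) (pp : (i : Fin m) → IsPrimePower (q i))
                  {N : ℕ} (A : Action q pp N) (x : Fin N) (n : Fin m → ℕ) where
  open Fixing q pp A x

  Stab : Vector ℕ m → Set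
  Stab = InStab q pp A x n

  Minimal : Vector ℕ m → Set
  Minimal = IsMinimal q pp A x n

  Multiple : Vector ℕ m → Vector ℕ m → Set
  Multiple = IsMultiple q pp A x n

  multiple-refl : ∀ g → Multiple g g
  multiple-refl g = 1 , z<s , λ j → sym (*-identityˡ (g j))

  multiple-trans : ∀ {g h h′} → Multiple g h → Multiple h h′ → Multiple g h′
  multiple-trans {g} {h} {h′} (k , k>0 , g≡kh) (k′ , k′>0 , h≡k′h′) =
    k * k′ , *-mono-< k>0 k′>0 , λ j → begin
      g j             ≡⟨ g≡kh j ⟩
      k * h j         ≡⟨ cong (k *_) (h≡k′h′ j) ⟩
      k * (k′ * h′ j) ≡⟨ sym (*-assoc k k′ (h′ j)) ⟩
      k * k′ * h′ j   ∎
    where open ≡-Reasoning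

  multiple-positive : ∀ {g h} i → Multiple g h → 0 < g i → 0 < h i
  multiple-positive {g} {h} i (k , _ , g≡kh) g>0 =
    proj₂ (factors-positive k (h i) (subst (0 <_) (g≡kh i) g>0))

  -- Two minimal elements related by coprime multiples a·h₁ = b·h₂ coincide:
  -- both are multiples of a common u ∈ G'ₓ, which must equal each of them.
  minimal-coprime-unique : ∀ {h₁ h₂} → Minimal h₁ → Minimal h₂ → ∀ a b → 0 < a → 0 < b →
                           Coprime a b → (∀ i → a * h₁ i ≡ b * h₂ i) → ∀ i → h₁ i ≡ h₂ i
  minimal-coprime-unique {h₁} {h₂} ((h₁<n , fix₁) , min₁) ((_ , fix₂) , min₂) a b a>0 b>0 coprime eq
    with coprime-common-part h₁ h₂ a b b>0 coprime eq
  ... | u , h₁≡bu , h₂≡au = min₂ h₁ (h₁<n , fix₁) (a , a>0 , h₂≡ah₁)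
    where
      u≤h₁ : ∀ i → u i ≤ h₁ i
      u≤h₁ i = subst (u i ≤_) (sym (h₁≡bu i)) (m≤n*m (u i) b {{>-nonZero b>0}})
      u-stab : Stab u
      u-stab = (λ i → ≤-<-trans (u≤h₁ i) (h₁<n i))
             , fixes-coprime a b u coprime (fixes-cong h₂≡au fix₂) (fixes-cong h₁≡bu fix₁)
      u≡h₁ : ∀ i → u i ≡ h₁ i
      u≡h₁ = min₁ u u-stab (b , b>0 , h₁≡bu)
      h₂≡ah₁ : ∀ i → h₂ i ≡ a * h₁ i
      h₂≡ah₁ i = trans (h₂≡au i) (cong (a *_) (u≡h₁ i))

  minimal-divisor-unique : ∀ {g h h′} → Minimal h → Multiple g h → Minimal h′ → Multiple g h′ →
                           ∀ i → h′ i ≡ h i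
  minimal-divisor-unique {g} {h} {h′} min (k , k>0 , g≡kh) min′ (k′ , k′>0 , g≡k′h′)
    with cancel-gcd h h′ k k′ k>0 k′>0 (λ i → trans (sym (g≡kh i)) (g≡k′h′ i))
  ... | a , b , a>0 , b>0 , coprime , eq =
    λ i → sym (minimal-coprime-unique min min′ a b a>0 b>0 coprime eq i)

  ProperFactor : Vector ℕ m → ℕ → Set
  ProperFactor g c = (∀ j → 2 + c ∣ g j) × Fixes (λ j → g j / (2 + c))

  properFactor? : ∀ g c → Dec (ProperFactor g c)
  properFactor? g c = all? (λ j → 2 + c ∣? g j)
                ×-dec (act (combine q pp (λ j → g j / (2 + c))) x Fin.≟ x)
    where open Action A

  reduce : ∀ i₀ g c → Stab g → 0 < g i₀ → ProperFactor g c →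
           Σ (Vector ℕ m) λ h → Stab h × h i₀ < g i₀ × Multiple g h
  reduce i₀ g c (g<n , _) g>0 (k∣g , fix) = (λ j → g j / k) , stab , smaller , (k , z<s , g≡kh)
    where
      k = 2 + c
      stab : Stab (λ j → g j / k)
      stab = (λ j → ≤-<-trans (m/n≤m (g j) k) (g<n j)) , fix
      smaller : g i₀ / k < g i₀
      smaller = m/n<m (g i₀) k {{>-nonZero g>0}} (s<s z<s)
      g≡kh : ∀ j → g j ≡ k * (g j / k)
      g≡kh j = sym (m*[n/m]≡n (k∣g j))

  -- An element of G'ₓ with no proper factor is minimal: a factor k ≥ 2 of g
  -- satisfies k ≤ gᵢ₀, so it would have been found by the bounded search.
  irreducible⇒minimal : ∀ i₀ g → Stab g → 0 < g i₀ →
                        (∀ c → c < g i₀ → ¬ ProperFactor g c) → Minimal g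
  irreducible⇒minimal i₀ g stab g>0 irreducible = stab , minimal
    where
      minimal : ∀ h → Stab h → Multiple g h → ∀ i → h i ≡ g i
      minimal h _         (suc zero , _ , g≡h) i = sym (trans (g≡h i) (*-identityˡ (h i)))
      minimal h (_ , fix) mult@(suc (suc c) , _ , g≡kh) i =
        ⊥-elim (irreducible c c<g (k∣g , fixes-cong h≡g/k fix))
        where
          k = 2 + c
          h>0 : 0 < h i₀
          h>0 = multiple-positive i₀ mult g>0
          c<g : c < g i₀
          c<g = <-≤-trans (s<s (n≤1+n c))
                          (≤-trans (m≤m*n k (h i₀) {{>-nonZero h>0}}) (≤-reflexive (sym (g≡kh i₀))))
          k∣g : ∀ j → k ∣ g j
          k∣g j = divides (h j) (trans (g≡kh j) (*-comm k (h j)))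
          h≡g/k : ∀ j → h j ≡ g j / k
          h≡g/k j = sym (trans (cong (_/ k) (g≡kh j)) (trans (cong (_/ k) (*-comm k (h j))) (m*n/n≡m (h j) k)))

  minimal-or-reducible : ∀ i₀ g → Stab g → 0 < g i₀ →
                         Minimal g ⊎ Σ (Vector ℕ m) λ h → Stab h × h i₀ < g i₀ × Multiple g h
  minimal-or-reducible i₀ g stab g>0 with any? {P = λ c → ProperFactor g (toℕ c)} (λ c → properFactor? g (toℕ c))
  ... | yes (c , factor) = inj₂ (reduce i₀ g (toℕ c) stab g>0 factor)
  ... | no  none         = inj₁ (irreducible⇒minimal i₀ g stab g>0 λ c c<g factor →
                             none (fromℕ< c<g , subst (ProperFactor g) (sym (toℕ-fromℕ< c<g)) factor))

  minimal-divisor-exists : ∀ i₀ g → Acc _<_ (g i₀) → Stab g → 0 < g i₀ →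
                           Σ (Vector ℕ m) λ h → Minimal h × Multiple g h
  minimal-divisor-exists i₀ g (acc smaller) stab g>0 with minimal-or-reducible i₀ g stab g>0
  ... | inj₁ min = g , min , multiple-refl g
  ... | inj₂ (h , stab-h , h<g , g∣h) with
        minimal-divisor-exists i₀ h (smaller h<g) stab-h (multiple-positive i₀ g∣h g>0)
  ...   | h′ , min′ , h∣h′ = h′ , min′ , multiple-trans g∣h h∣h′

proposition1 :
    {m : ℕ} (q : Fin m → ℕ) (pp : (i : Fin m) → IsPrimePower (q i))
    {N : ℕ} (A : Action q pp N) (x : Fin N) (n : Fin m → ℕ) →
    IsOrbitOrder q pp A x n →
    (g : (i : Fin m) → ℕ) → InStab q pp A x n g → IsNonzero q pp A x n g →
    Σ ((i : Fin m) → ℕ) λ h →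
      (IsMinimal q pp A x n h × IsMultiple q pp A x n g h)
      × (∀ h′ → IsMinimal q pp A x n h′ → IsMultiple q pp A x n g h′ → ∀ i → h′ i ≡ h i)
proposition1 {m} q pp A x n _ g stab nonzero =
  let (i₀ , gᵢ₀≢0) = ¬∀⟶∃¬ m (λ i → g i ≡ 0) (λ i → g i ≟ 0) nonzero
      (h , min , g∣h) = minimal-divisor-exists i₀ g (<-wellFounded (g i₀)) stab (n≢0⇒n>0 gᵢ₀≢0)
  in h , (min , g∣h) , λ h′ min′ g∣h′ → minimal-divisor-unique min g∣h min′ g∣h′
  where open Stabilizer q pp A x n
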